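{- Let $\nu$ be a lattice path and $T,T'$ two $\nu$-trees. Then $|T\setminus T'|=|T'\setminus T|=1$ if and only if one of $T,T'$ is obtained from the other by a right rotation.
   Context: A lattice path $\nu$ is a finite sequence of unit north and east steps. $F_\nu$ is the Ferrers diagram weakly above $\nu$ inside the smallest axis-parallel rectangle containing $\nu$, and $A_\nu$ its set of lattice points. Points $p,q\in A_\nu$ are $\nu$-incompatible if one lies strictly southwest of the other and the smallest axis-parallel rectangle containing them lies inside $F_\nu$; otherwise $\nu$-compatible. A $\nu$-tree is an inclusion-maximal set of pairwise $\nu$-compatible points of $A_\nu$. A $\nu$-tree $T'$ is obtained from a $\nu$-tree $T$ by a right rotation if there are points $p,q,r,q'\in A_\nu$ with $q$ strictly below $p$ in the same column, $r$ strictly to the right of $q$ in the same row, and $q'$ having the column of $r$ and the row of $p$, such that $p,r,q\in T$, $T'=(T\setminus\{q\})\cup\{q'\}$, no other point of $T$ lies on the segments $[p,q]$, $[q,r]$, and no other point of $T'$ lies on the segments $[p,q']$, $[q',r]$. -}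

module Defs where

open import Data.Nat using (ℕ; zero; suc; _≤_; _<_)
open import Data.Bool using (Bool; true)
open import Data.List using (List; []; _∷_)
open import Data.List.Membership.Propositional using (_∈_)
open import Data.Product using (Σ; _×_; _,_; proj₁; proj₂; ∃-syntax)
open import Data.Sum using (_⊎_)
open import Relation.Nullary using (¬_)
open import Relation.Binary.PropositionalEquality using (_≡_; _≢_)

-- Lattice paths (starting at the origin, w.l.o.g. up to translation)

data Step : Set where
  N E : Step

Path : Set
Path = List Step

Point : Set
Point = ℕ × ℕ

xc yc : Point → ℕ
xc = proj₁
yc = proj₂

width : Path → ℕ
width []      = 0
width (N ∷ s) = width s
width (E ∷ s) = suc (width s)

height : Path → ℕ
height []      = 0
height (N ∷ s) = suc (height s)
height (E ∷ s) = height s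

visitedFrom : Point → Path → List Point
visitedFrom p []      = p ∷ []
visitedFrom p (N ∷ s) = p ∷ visitedFrom (xc p , suc (yc p)) s
visitedFrom p (E ∷ s) = p ∷ visitedFrom (suc (xc p) , yc p) s

visited : Path → List Point
visited = visitedFrom (0 , 0)

InA : Path → Point → Set
InA ν p = xc p ≤ width ν × yc p ≤ height ν
        × ∃[ y ] ((xc p , y) ∈ visited ν × y ≤ yc p)

-- the (closed) rectangle spanned by p (south-west) and q lies in F_ν:
-- every lattice point of the rectangle lies in A_ν
RectInside : Path → Point → Point → Set
RectInside ν p q = ∀ (s : Point) → xc p ≤ xc s → xc s ≤ xc q
                 → yc p ≤ yc s → yc s ≤ yc q → InA ν s

StrictSW : Point → Point → Set
StrictSW p q = xc p < xc q × yc p < yc q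

Incompatible : Path → Point → Point → Set
Incompatible ν p q = (StrictSW p q × RectInside ν p q)
                   ⊎ (StrictSW q p × RectInside ν q p)

Compatible : Path → Point → Point → Set
Compatible ν p q = ¬ Incompatible ν p q

PointSet : Set
PointSet = Point → Bool

_∈ₛ_ : Point → PointSet → Set
p ∈ₛ T = T p ≡ true

CompatibleSet : Path → PointSet → Set
CompatibleSet ν T = (∀ p → p ∈ₛ T → InA ν p)
                  × (∀ p q → p ∈ₛ T → q ∈ₛ T → Compatible ν p q)

IsTree : Path → PointSet → Set
IsTree ν T = CompatibleSet ν T
           × (∀ p → InA ν p → (∀ q → q ∈ₛ T → Compatible ν p q) → p ∈ₛ T)

DiffSizeOne : PointSet → PointSet → Set
DiffSizeOne T T' = Σ Point λ p → (p ∈ₛ T × ¬ p ∈ₛ T')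
                 × (∀ s → s ∈ₛ T → ¬ s ∈ₛ T' → s ≡ p)

OnVSeg : ℕ → ℕ → ℕ → Point → Set
OnVSeg x y₁ y₂ s = xc s ≡ x × y₁ ≤ yc s × yc s ≤ y₂

OnHSeg : ℕ → ℕ → ℕ → Point → Set
OnHSeg y x₁ x₂ s = yc s ≡ y × x₁ ≤ xc s × xc s ≤ x₂

RightRotation : Path → PointSet → PointSet → Set
RightRotation ν T T' =
  Σ Point λ p → Σ Point λ q → Σ Point λ r → Σ Point λ q' →
    InA ν p × InA ν q × InA ν r × InA ν q'
  × (xc q ≡ xc p × yc q < yc p)
  × (yc r ≡ yc q × xc q < xc r)
  × (q' ≡ (xc r , yc p))
  × p ∈ₛ T × r ∈ₛ T × q ∈ₛ T
  × (∀ s → s ∈ₛ T' → ((s ∈ₛ T × s ≢ q) ⊎ s ≡ q'))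
  × (∀ s → ((s ∈ₛ T × s ≢ q) ⊎ s ≡ q') → s ∈ₛ T')
  × (∀ s → s ∈ₛ T → OnVSeg (xc p) (yc q) (yc p) s → s ≡ p ⊎ s ≡ q)
  × (∀ s → s ∈ₛ T → OnHSeg (yc q) (xc q) (xc r) s → s ≡ q ⊎ s ≡ r)
  × (∀ s → s ∈ₛ T' → OnHSeg (yc p) (xc p) (xc q') s → s ≡ p ⊎ s ≡ q')
  × (∀ s → s ∈ₛ T' → OnVSeg (xc q') (yc r) (yc q') s → s ≡ q' ⊎ s ≡ r)

-- If T ∖ T' = {x} and T' ∖ T = {y}, then x and y are incompatible, since otherwise maximality
-- of T would put y in T; say x = (a , c) lies south-west of y = (d , b). Because A_ν is closed
-- towards the north-west, incompatibility of two points is decided by the south-east corner of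
-- their rectangle alone. With this, any point of T incompatible with p = (a , b) or r = (d , c),
-- or lying strictly inside a side of the rectangle x p y r, is seen to be incompatible with x or
-- with y; so p, r ∈ T by maximality and T' arises from T by the right rotation at x.
-- Conversely, a right rotation exchanges q for q', and q' ∉ T as q and q' are incompatible
-- through the corner r.

module Submission where

open import Defs
open import Data.Product using (_×_)
open import Data.Sum using (_⊎_)
open import Function.Bundles using (_⇔_)

open import Data.Nat using (ℕ; suc; z≤n; _≤_; _<_; _≟_; _≤?_; _<?_)
open import Data.Nat.Properties
open import Data.Bool using (true)
import Data.Bool.Properties as Bool
open import Data.List using (List; []; _∷_)
open import Data.List.Relation.Unary.Any using (Any; here; there; any?)
open import Data.List.Membership.Propositional using (_∈_; find; lose)
open import Data.Product using (_,_; proj₁; proj₂; ∃-syntax; swap)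
open import Data.Product.Properties using (,-injectiveˡ; ,-injectiveʳ; ≡-dec)
open import Data.Sum using (inj₁; inj₂; [_,_]) renaming (swap to ⊎-swap)
open import Data.Empty using (⊥-elim)
open import Relation.Nullary using (¬_; Dec; yes; no; contradiction)
open import Relation.Nullary.Decidable using (_×-dec_; map′)
open import Relation.Binary.PropositionalEquality using (_≡_; _≢_; refl)
open import Function.Bundles using (mk⇔)
open import Function using (_∘_)

visitedFrom-yc-≥ : ∀ ν x₀ y₀ {x y} → (x , y) ∈ visitedFrom (x₀ , y₀) ν → y₀ ≤ y
visitedFrom-yc-≥ []      x₀ y₀ (here refl) = ≤-refl
visitedFrom-yc-≥ []      x₀ y₀ (there ())
visitedFrom-yc-≥ (N ∷ ν) x₀ y₀ (here refl) = ≤-refl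
visitedFrom-yc-≥ (N ∷ ν) x₀ y₀ (there m)   = ≤-trans (n≤1+n y₀) (visitedFrom-yc-≥ ν x₀ (suc y₀) m)
visitedFrom-yc-≥ (E ∷ ν) x₀ y₀ (here refl) = ≤-refl
visitedFrom-yc-≥ (E ∷ ν) x₀ y₀ (there m)   = visitedFrom-yc-≥ ν (suc x₀) y₀ m

visitedFrom-column-below : ∀ ν x₀ y₀ {x y} → (x , y) ∈ visitedFrom (x₀ , y₀) ν
  → ∀ {u} → x₀ ≤ u → u ≤ x → ∃[ y' ] ((u , y') ∈ visitedFrom (x₀ , y₀) ν × y' ≤ y)
visitedFrom-column-below []      x₀ y₀ (here refl) x₀≤u u≤x with refl ← ≤-antisym u≤x x₀≤u =
  y₀ , here refl , ≤-refl
visitedFrom-column-below []      x₀ y₀ (there ()) _ _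
visitedFrom-column-below (N ∷ ν) x₀ y₀ (here refl) x₀≤u u≤x with refl ← ≤-antisym u≤x x₀≤u =
  y₀ , here refl , ≤-refl
visitedFrom-column-below (N ∷ ν) x₀ y₀ (there m) x₀≤u u≤x
  with y' , m' , y'≤y ← visitedFrom-column-below ν x₀ (suc y₀) m x₀≤u u≤x = y' , there m' , y'≤y
visitedFrom-column-below (E ∷ ν) x₀ y₀ (here refl) x₀≤u u≤x with refl ← ≤-antisym u≤x x₀≤u =
  y₀ , here refl , ≤-refl
visitedFrom-column-below (E ∷ ν) x₀ y₀ (there m) {u} x₀≤u u≤x with x₀ ≟ u
... | yes refl = y₀ , here refl , visitedFrom-yc-≥ ν (suc x₀) y₀ m
... | no x₀≢u with y' , m' , y'≤y ← visitedFrom-column-below ν (suc x₀) y₀ m (≤∧≢⇒< x₀≤u x₀≢u) u≤x =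
  y' , there m' , y'≤y

InA-upLeft-closed : ∀ ν {x y u v} → InA ν (x , y) → u ≤ x → y ≤ v → v ≤ height ν → InA ν (u , v)
InA-upLeft-closed ν (x≤w , _ , y₀ , m , y₀≤y) u≤x y≤v v≤h
  with y₁ , m' , y₁≤y₀ ← visitedFrom-column-below ν 0 0 m z≤n u≤x =
  ≤-trans u≤x x≤w , v≤h , y₁ , m' , ≤-trans y₁≤y₀ (≤-trans y₀≤y y≤v)

InA-left-closed : ∀ ν {x y u} → InA ν (x , y) → u ≤ x → InA ν (u , y)
InA-left-closed ν p∈A u≤x = InA-upLeft-closed ν p∈A u≤x ≤-refl (proj₁ (proj₂ p∈A))

visited-below? : ∀ x y (L : List Point) → Dec (∃[ y' ] ((x , y') ∈ L × y' ≤ y))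
visited-below? x y L = map′ from to (any? (λ s → (xc s ≟ x) ×-dec (yc s ≤? y)) L)
  where
  from : Any (λ s → xc s ≡ x × yc s ≤ y) L → ∃[ y' ] ((x , y') ∈ L × y' ≤ y)
  from a with (_ , v) , m , refl , v≤y ← find a = v , m , v≤y
  to : ∃[ y' ] ((x , y') ∈ L × y' ≤ y) → Any (λ s → xc s ≡ x × yc s ≤ y) L
  to (_ , m , y'≤y) = lose m (refl , y'≤y)

InA? : ∀ ν p → Dec (InA ν p)
InA? ν (x , y) = (x ≤? width ν) ×-dec ((y ≤? height ν) ×-dec visited-below? x y (visited ν))

_∈ₛ?_ : ∀ s (T : PointSet) → Dec (s ∈ₛ T)
s ∈ₛ? T = T s Bool.≟ true

_≟ₚ_ : (p q : Point) → Dec (p ≡ q)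
_≟ₚ_ = ≡-dec _≟_ _≟_

column≢ : ∀ {u v u' v' : ℕ} → u ≢ u' → (u , v) ≢ (u' , v')
column≢ u≢u' = u≢u' ∘ ,-injectiveˡ

row≢ : ∀ {u v u' v' : ℕ} → v ≢ v' → (u , v) ≢ (u' , v')
row≢ v≢v' = v≢v' ∘ ,-injectiveʳ

endpoint-or-interior : ∀ {lo w hi} → lo ≤ w → w ≤ hi → w ≡ lo ⊎ w ≡ hi ⊎ (lo < w × w < hi)
endpoint-or-interior {lo} {w} {hi} lo≤w w≤hi with lo ≟ w | w ≟ hi
... | yes refl | _        = inj₁ refl
... | no _     | yes refl = inj₂ (inj₁ refl)
... | no lo≢w  | no w≢hi  = inj₂ (inj₂ (≤∧≢⇒< lo≤w lo≢w , ≤∧≢⇒< w≤hi w≢hi))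

-- The rectangle spanned by p and q lies in F_ν iff its south-east corner lies in A_ν
-- (and q does), so this is incompatibility with p the south-west point.
IncompatibleSW : Path → Point → Point → Set
IncompatibleSW ν p q = StrictSW p q × InA ν (xc q , yc p)

IncompatibleSW? : ∀ ν p q → Dec (IncompatibleSW ν p q)
IncompatibleSW? ν p q = ((xc p <? xc q) ×-dec (yc p <? yc q)) ×-dec InA? ν (xc q , yc p)

corner⇒RectInside : ∀ ν {p q} → InA ν (xc q , yc p) → yc q ≤ height ν → RectInside ν p q
corner⇒RectInside ν corner∈A yq≤h s _ xs≤xq yp≤ys ys≤yq =
  InA-upLeft-closed ν corner∈A xs≤xq yp≤ys (≤-trans ys≤yq yq≤h)

incompatibleSW⇒incompatible : ∀ ν {p q} → InA ν q → IncompatibleSW ν p q → Incompatible ν p q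
incompatibleSW⇒incompatible ν q∈A (sw , corner∈A) =
  inj₁ (sw , corner⇒RectInside ν corner∈A (proj₁ (proj₂ q∈A)))

incompatible⇒incompatibleSW : ∀ ν {p q} → Incompatible ν p q
  → IncompatibleSW ν p q ⊎ IncompatibleSW ν q p
incompatible⇒incompatibleSW ν {p} {q} (inj₁ ((xp<xq , yp<yq) , R)) =
  inj₁ ((xp<xq , yp<yq) , R (xc q , yc p) (<⇒≤ xp<xq) ≤-refl ≤-refl (<⇒≤ yp<yq))
incompatible⇒incompatibleSW ν {p} {q} (inj₂ ((xq<xp , yq<yp) , R)) =
  inj₂ ((xq<xp , yq<yp) , R (xc p , yc q) (<⇒≤ xq<xp) ≤-refl ≤-refl (<⇒≤ yq<yp))

¬compatible⇒incompatibleSW : ∀ ν {p q} → ¬ Compatible ν p q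
  → IncompatibleSW ν p q ⊎ IncompatibleSW ν q p
¬compatible⇒incompatibleSW ν {p} {q} ¬compatible
  with IncompatibleSW? ν p q | IncompatibleSW? ν q p
... | yes p↯q | _       = inj₁ p↯q
... | no _    | yes q↯p = inj₂ q↯p
... | no ¬p↯q | no ¬q↯p =
  contradiction (λ p↯q → [ ¬p↯q , ¬q↯p ] (incompatible⇒incompatibleSW ν p↯q)) ¬compatible

module _ {ν : Path} {T : PointSet} (tree : IsTree ν T) where

  tree-InA : ∀ {p} → p ∈ₛ T → InA ν p
  tree-InA = proj₁ (proj₁ tree) _

  tree-¬incompatibleSW : ∀ {p q} → p ∈ₛ T → q ∈ₛ T → ¬ IncompatibleSW ν p q
  tree-¬incompatibleSW p∈T q∈T p↯q =
    proj₂ (proj₁ tree) _ _ p∈T q∈T (incompatibleSW⇒incompatible ν (tree-InA q∈T) p↯q)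

  tree-maximal : ∀ {p} → InA ν p
    → (∀ {t} → t ∈ₛ T → ¬ IncompatibleSW ν p t)
    → (∀ {t} → t ∈ₛ T → ¬ IncompatibleSW ν t p)
    → p ∈ₛ T
  tree-maximal p∈A ¬p↯ ¬↯p = proj₂ tree _ p∈A λ t t∈T p↯t →
    [ ¬p↯ t∈T , ¬↯p t∈T ] (incompatible⇒incompatibleSW ν p↯t)

∈-of-unique-missing : ∀ {T T' : PointSet} {x s} → (∀ s → s ∈ₛ T → ¬ s ∈ₛ T' → s ≡ x)
  → s ∈ₛ T → s ≢ x → s ∈ₛ T'
∈-of-unique-missing {T' = T'} {s = s} T∖T'⊆x s∈T s≢x with s ∈ₛ? T'
... | yes s∈T' = s∈T'
... | no s∉T' = contradiction (T∖T'⊆x s s∈T s∉T') s≢x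

exchanged-points-incompatible : ∀ {ν T T' x y} → IsTree ν T → IsTree ν T'
  → x ∈ₛ T → (∀ s → s ∈ₛ T → ¬ s ∈ₛ T' → s ≡ x) → y ∈ₛ T' → ¬ y ∈ₛ T
  → IncompatibleSW ν x y ⊎ IncompatibleSW ν y x
exchanged-points-incompatible {ν} {T} {T'} {x} {y} treeT treeT' x∈T T∖T'⊆x y∈T' y∉T =
  ⊎-swap (¬compatible⇒incompatibleSW ν λ y~x →
    y∉T (proj₂ treeT y (tree-InA treeT' y∈T') (compatible-with-T y~x)))
  where
  compatible-with-T : Compatible ν y x → ∀ t → t ∈ₛ T → Compatible ν y t
  compatible-with-T y~x t t∈T with t ≟ₚ x
  ... | yes refl = y~x
  ... | no t≢x = proj₂ (proj₁ treeT') y t y∈T' (∈-of-unique-missing T∖T'⊆x t∈T t≢x)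

module ExchangeToRotation
  {ν : Path} {T T' : PointSet} (treeT : IsTree ν T) (treeT' : IsTree ν T') {a c d b : ℕ}
  (x∈T : (a , c) ∈ₛ T) (x∉T' : ¬ (a , c) ∈ₛ T') (T∖T'⊆x : ∀ s → s ∈ₛ T → ¬ s ∈ₛ T' → s ≡ (a , c))
  (y∈T' : (d , b) ∈ₛ T') (y∉T : ¬ (d , b) ∈ₛ T) (T'∖T⊆y : ∀ s → s ∈ₛ T' → ¬ s ∈ₛ T → s ≡ (d , b))
  (x↯y : IncompatibleSW ν (a , c) (d , b)) where

  a<d : a < d
  a<d = proj₁ (proj₁ x↯y)

  c<b : c < b
  c<b = proj₂ (proj₁ x↯y)

  r∈A : InA ν (d , c)
  r∈A = proj₂ x↯y

  b≤h : b ≤ height ν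
  b≤h = proj₁ (proj₂ (tree-InA treeT' y∈T'))

  rect∈A : ∀ {u v} → u ≤ d → c ≤ v → v ≤ b → InA ν (u , v)
  rect∈A u≤d c≤v v≤b = InA-upLeft-closed ν r∈A u≤d c≤v (≤-trans v≤b b≤h)

  ¬x↯ : ∀ {t} → t ∈ₛ T → ¬ IncompatibleSW ν (a , c) t
  ¬x↯ = tree-¬incompatibleSW treeT x∈T

  ¬↯x : ∀ {t} → t ∈ₛ T → ¬ IncompatibleSW ν t (a , c)
  ¬↯x t∈T = tree-¬incompatibleSW treeT t∈T x∈T

  ¬y↯ : ∀ {t} → t ∈ₛ T' → ¬ IncompatibleSW ν (d , b) t
  ¬y↯ = tree-¬incompatibleSW treeT' y∈T'

  ¬↯y : ∀ {t} → t ∈ₛ T' → ¬ IncompatibleSW ν t (d , b)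
  ¬↯y t∈T' = tree-¬incompatibleSW treeT' t∈T' y∈T'

  ∈T' : ∀ {s} → s ∈ₛ T → s ≢ (a , c) → s ∈ₛ T'
  ∈T' = ∈-of-unique-missing T∖T'⊆x

  ∈T : ∀ {s} → s ∈ₛ T' → s ≢ (d , b) → s ∈ₛ T
  ∈T = ∈-of-unique-missing T'∖T⊆y

  p∈T : (a , b) ∈ₛ T
  p∈T = tree-maximal treeT (rect∈A (<⇒≤ a<d) (<⇒≤ c<b) ≤-refl) ¬p↯ ¬↯p
    where
    ¬p↯ : ∀ {t} → t ∈ₛ T → ¬ IncompatibleSW ν (a , b) t
    ¬p↯ {u , v} t∈T ((a<u , b<v) , ub∈A) with d <? u
    ... | yes d<u = ¬y↯ (∈T' t∈T (column≢ (>⇒≢ a<u))) ((d<u , b<v) , ub∈A)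
    ... | no d≮u  = ¬x↯ t∈T ((a<u , <-trans c<b b<v) , rect∈A (≮⇒≥ d≮u) ≤-refl (<⇒≤ c<b))
    ¬↯p : ∀ {t} → t ∈ₛ T → ¬ IncompatibleSW ν t (a , b)
    ¬↯p {u , v} t∈T ((u<a , v<b) , av∈A) with v <? c
    ... | yes v<c = ¬↯x t∈T ((u<a , v<c) , av∈A)
    ... | no v≮c  = ¬↯y (∈T' t∈T (column≢ (<⇒≢ u<a)))
                        ((<-trans u<a a<d , v<b) , rect∈A ≤-refl (≮⇒≥ v≮c) (<⇒≤ v<b))

  r∈T : (d , c) ∈ₛ T
  r∈T = tree-maximal treeT r∈A ¬r↯ ¬↯r
    where
    ¬r↯ : ∀ {t} → t ∈ₛ T → ¬ IncompatibleSW ν (d , c) t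
    ¬r↯ {u , v} t∈T ((d<u , c<v) , uc∈A) with b <? v
    ... | yes b<v = ¬y↯ (∈T' t∈T (column≢ (>⇒≢ (<-trans a<d d<u))))
                        ((d<u , b<v) , InA-upLeft-closed ν uc∈A ≤-refl (<⇒≤ c<b) b≤h)
    ... | no _    = ¬x↯ t∈T ((<-trans a<d d<u , c<v) , uc∈A)
    ¬↯r : ∀ {t} → t ∈ₛ T → ¬ IncompatibleSW ν t (d , c)
    ¬↯r {u , v} t∈T ((u<d , v<c) , dv∈A) with u <? a
    ... | yes u<a = ¬↯x t∈T ((u<a , v<c) , InA-left-closed ν dv∈A (<⇒≤ a<d))
    ... | no _    = ¬↯y (∈T' t∈T (row≢ (<⇒≢ v<c))) ((u<d , <-trans v<c c<b) , dv∈A)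

  T-on-pq : ∀ s → s ∈ₛ T → OnVSeg a c b s → s ≡ (a , b) ⊎ s ≡ (a , c)
  T-on-pq (_ , w) s∈T (refl , c≤w , w≤b) with endpoint-or-interior c≤w w≤b
  ... | inj₁ refl                 = inj₂ refl
  ... | inj₂ (inj₁ refl)          = inj₁ refl
  ... | inj₂ (inj₂ (c<w , w<b))   =
    ⊥-elim (¬↯y (∈T' s∈T (row≢ (>⇒≢ c<w))) ((a<d , w<b) , rect∈A ≤-refl (<⇒≤ c<w) (<⇒≤ w<b)))

  T-on-qr : ∀ s → s ∈ₛ T → OnHSeg c a d s → s ≡ (a , c) ⊎ s ≡ (d , c)
  T-on-qr (w , _) s∈T (refl , a≤w , w≤d) with endpoint-or-interior a≤w w≤d
  ... | inj₁ refl                 = inj₁ refl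
  ... | inj₂ (inj₁ refl)          = inj₂ refl
  ... | inj₂ (inj₂ (a<w , w<d))   = ⊥-elim (¬↯y (∈T' s∈T (column≢ (>⇒≢ a<w))) ((w<d , c<b) , r∈A))

  T'-on-pq' : ∀ s → s ∈ₛ T' → OnHSeg b a d s → s ≡ (a , b) ⊎ s ≡ (d , b)
  T'-on-pq' (w , _) s∈T' (refl , a≤w , w≤d) with endpoint-or-interior a≤w w≤d
  ... | inj₁ refl                 = inj₁ refl
  ... | inj₂ (inj₁ refl)          = inj₂ refl
  ... | inj₂ (inj₂ (a<w , w<d))   =
    ⊥-elim (¬x↯ (∈T s∈T' (column≢ (<⇒≢ w<d))) ((a<w , c<b) , rect∈A (<⇒≤ w<d) ≤-refl (<⇒≤ c<b)))

  T'-on-q'r : ∀ s → s ∈ₛ T' → OnVSeg d c b s → s ≡ (d , b) ⊎ s ≡ (d , c)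
  T'-on-q'r (_ , w) s∈T' (refl , c≤w , w≤b) with endpoint-or-interior c≤w w≤b
  ... | inj₁ refl                 = inj₂ refl
  ... | inj₂ (inj₁ refl)          = inj₁ refl
  ... | inj₂ (inj₂ (c<w , w<b))   = ⊥-elim (¬x↯ (∈T s∈T' (row≢ (<⇒≢ w<b))) ((a<d , c<w) , r∈A))

  T'⊆exchange : ∀ s → s ∈ₛ T' → (s ∈ₛ T × s ≢ (a , c)) ⊎ s ≡ (d , b)
  T'⊆exchange s s∈T' with s ∈ₛ? T
  ... | yes s∈T = inj₁ (s∈T , λ { refl → x∉T' s∈T' })
  ... | no s∉T  = inj₂ (T'∖T⊆y s s∈T' s∉T)

  exchange⊆T' : ∀ s → (s ∈ₛ T × s ≢ (a , c)) ⊎ s ≡ (d , b) → s ∈ₛ T'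
  exchange⊆T' s (inj₁ (s∈T , s≢x)) = ∈T' s∈T s≢x
  exchange⊆T' s (inj₂ refl)        = y∈T'

  rightRotation : RightRotation ν T T'
  rightRotation =
    (a , b) , (a , c) , (d , c) , (d , b)
    , rect∈A (<⇒≤ a<d) (<⇒≤ c<b) ≤-refl , tree-InA treeT x∈T , r∈A , tree-InA treeT' y∈T'
    , (refl , c<b) , (refl , a<d) , refl
    , p∈T , r∈T , x∈T , T'⊆exchange , exchange⊆T'
    , T-on-pq , T-on-qr , T'-on-pq' , T'-on-q'r

rotation⇒exchange : ∀ {ν T T'} → IsTree ν T → RightRotation ν T T'
  → DiffSizeOne T T' × DiffSizeOne T' T
rotation⇒exchange {T = T} {T'} treeT
  ((a , b) , (_ , c) , (d , _) , _ , _ , _ , r∈A , _ , (refl , c<b) , (refl , a<d) , refl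
  , _ , _ , q∈T , T'⊆exchange , exchange⊆T' , _) =
  ((a , c) , (q∈T , q∉T') , T∖T'⊆q) , ((d , b) , (q'∈T' , q'∉T) , T'∖T⊆q')
  where
  q∉T' : ¬ (a , c) ∈ₛ T'
  q∉T' q∈T' with T'⊆exchange _ q∈T'
  ... | inj₁ (_ , q≢q) = q≢q refl
  ... | inj₂ q≡q'      = <⇒≢ a<d (,-injectiveˡ q≡q')

  T∖T'⊆q : ∀ s → s ∈ₛ T → ¬ s ∈ₛ T' → s ≡ (a , c)
  T∖T'⊆q s s∈T s∉T' with s ≟ₚ (a , c)
  ... | yes s≡q = s≡q
  ... | no s≢q  = contradiction (exchange⊆T' s (inj₁ (s∈T , s≢q))) s∉T'

  q'∈T' : (d , b) ∈ₛ T'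
  q'∈T' = exchange⊆T' _ (inj₂ refl)

  q'∉T : ¬ (d , b) ∈ₛ T
  q'∉T q'∈T = tree-¬incompatibleSW treeT q∈T q'∈T ((a<d , c<b) , r∈A)

  T'∖T⊆q' : ∀ s → s ∈ₛ T' → ¬ s ∈ₛ T → s ≡ (d , b)
  T'∖T⊆q' s s∈T' s∉T with T'⊆exchange s s∈T'
  ... | inj₁ (s∈T , _) = contradiction s∈T s∉T
  ... | inj₂ s≡q'      = s≡q'

lemma2p12 : (ν : Path) (T T' : PointSet) → IsTree ν T → IsTree ν T'
    → (DiffSizeOne T T' × DiffSizeOne T' T) ⇔ (RightRotation ν T T' ⊎ RightRotation ν T' T)
lemma2p12 ν T T' treeT treeT' = mk⇔ exchange⇒rotation rotation⇒exchange′
  where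
  exchange⇒rotation : DiffSizeOne T T' × DiffSizeOne T' T
    → RightRotation ν T T' ⊎ RightRotation ν T' T
  exchange⇒rotation ((_ , (x∈T , x∉T') , T∖T'⊆x) , (_ , (y∈T' , y∉T) , T'∖T⊆y))
    with exchanged-points-incompatible treeT treeT' x∈T T∖T'⊆x y∈T' y∉T
  ... | inj₁ x↯y = inj₁ (ExchangeToRotation.rightRotation
                          treeT treeT' x∈T x∉T' T∖T'⊆x y∈T' y∉T T'∖T⊆y x↯y)
  ... | inj₂ y↯x = inj₂ (ExchangeToRotation.rightRotation
                          treeT' treeT y∈T' y∉T T'∖T⊆y x∈T x∉T' T∖T'⊆x y↯x)

  rotation⇒exchange′ : RightRotation ν T T' ⊎ RightRotation ν T' T
    → DiffSizeOne T T' × DiffSizeOne T' T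
  rotation⇒exchange′ (inj₁ rot) = rotation⇒exchange treeT rot
  rotation⇒exchange′ (inj₂ rot) = swap (rotation⇒exchange treeT' rot)
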